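{- Let $\mathcal{A}$ be a finite set with a sparse statistic $D:\mathcal{A}\to 2^{[N-1]}$, and let $n=\lfloor N/2\rfloor$. Suppose there are constants $b_k\in\mathbb{N}_0$, $0\le k\le n$, such that for every sparse set $J\subseteq[N-1]$, $|\{a\in\mathcal{A}\mid D(a)\supseteq J\}|=b_{|J|}$. Then $\mathcal{A}$ is symmetric with respect to $D$.
   Context: For $J \subseteq [N-1]$, $F_{N,J} = \sum x_{i_1}\cdots x_{i_N}$ over $i_1 \le \dots \le i_N$ with $i_j < i_{j+1}$ for $j\in J$. For a finite set $\mathcal{A}$ with $D:\mathcal{A}\to 2^{[N-1]}$, $\mathcal{Q}_{N,D}(\mathcal{A})=\sum_a F_{N,D(a)}$, and $\mathcal{A}$ is symmetric w.r.t. $D$ if $\mathcal{Q}_{N,D}(\mathcal{A})$ is a symmetric function. A set $J\subseteq[N-1]$ is sparse if $\{j,j+1\}\not\subseteq J$ for all $1\le j\le N-2$; $D$ is sparse if every $D(a)$ is sparse. -}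

module Defs where

open import Data.Bool using (Bool; true; false; _∧_; if_then_else_)
open import Data.Nat using (ℕ; zero; suc; pred; _+_; _<ᵇ_; _≤ᵇ_; _≡ᵇ_)
open import Data.Fin using (Fin; toℕ)
open import Data.Fin.Subset using (Subset; _∈_; _⊆_; ∣_∣)
open import Data.Fin.Subset.Properties using (_⊆?_)
open import Data.Fin.Permutation using (Permutation′; _⟨$⟩ʳ_)
open import Data.List using (List; []; _∷_; map; concatMap; upTo; length; filter; filterᵇ; allFin; foldr)
open import Data.Vec using (toList)
open import Relation.Binary.PropositionalEquality using (_≡_)
open import Data.Empty using (⊥)

-- A subset J ⊆ [N-1] = {1,…,N-1} is a `Subset (pred N)`; the element
-- j : Fin (pred N) stands for the integer toℕ j + 1 ∈ [N-1].
-- The variables are x_0, x_1, x_2, … (indexing is immaterial).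
-- A finite set 𝒜 with statistic D is modelled as Fin k with D : Fin k → Subset (pred N).

Sparse : (N : ℕ) → Subset (pred N) → Set
Sparse N J = (i j : Fin (pred N)) → toℕ j ≡ suc (toℕ i) → i ∈ J → j ∈ J → ⊥

allSeqs : ℕ → ℕ → List (List ℕ)
allSeqs m zero = [] ∷ []
allSeqs m (suc N) = concatMap (λ s → map (_∷ s) (upTo m)) (allSeqs m N)

-- Given the indicator list (b_1,…,b_{N-1}) of J, checks i_1 ≤ i_2 ≤ … ≤ i_N
-- with i_j < i_{j+1} whenever b_j = true (i.e. j ∈ J).
admissible : List Bool → List ℕ → Bool
admissible (b ∷ bs) (x ∷ y ∷ rest) =
  (if b then x <ᵇ y else x ≤ᵇ y) ∧ admissible bs (y ∷ rest)
admissible _ _ = true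

occ : ℕ → List ℕ → ℕ
occ v [] = 0
occ v (x ∷ s) = if v ≡ᵇ x then suc (occ v s) else occ v s

allᵇ : {A : Set} → (A → Bool) → List A → Bool
allᵇ p = foldr (λ x acc → p x ∧ acc) true

-- the monomial x_{i_1}⋯x_{i_N} equals x^e (e an exponent vector on x_0,…,x_{m-1})
monoIs : (m : ℕ) → (Fin m → ℕ) → List ℕ → Bool
monoIs m e s = allᵇ (λ v → occ (toℕ v) s ≡ᵇ e v) (allFin m)

-- Coefficient of the monomial x_0^{e_0}⋯x_{m-1}^{e_{m-1}} in F_{N,J}
-- (the number of terms x_{i_1}⋯x_{i_N} of F_{N,J} equal to this monomial).
coeffF : (N : ℕ) → Subset (pred N) → (m : ℕ) → (Fin m → ℕ) → ℕ
coeffF N J m e =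
  length (filterᵇ (λ s → admissible (toList J) s ∧ monoIs m e s) (allSeqs m N))

-- Coefficient of x^e in Q_{N,D}(𝒜) = Σ_{a ∈ 𝒜} F_{N,D(a)}.
coeffQ : (N k : ℕ) → (Fin k → Subset (pred N)) → (m : ℕ) → (Fin m → ℕ) → ℕ
coeffQ N k D m e = foldr (λ a acc → coeffF N (D a) m e + acc) 0 (allFin k)

-- Q_{N,D}(𝒜) is a symmetric function: every coefficient is invariant under
-- permuting the variables (every monomial involves only x_0,…,x_{m-1} for some m).
IsSymmetric : (N k : ℕ) → (Fin k → Subset (pred N)) → Set
IsSymmetric N k D =
  (m : ℕ) (e : Fin m → ℕ) (σ : Permutation′ m) →
  coeffQ N k D m e ≡ coeffQ N k D m (λ v → e (σ ⟨$⟩ʳ v))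

countSuper : (N k : ℕ) → (Fin k → Subset (pred N)) → Subset (pred N) → ℕ
countSuper N k D J = length (filter (λ a → J ⊆? D a) (allFin k))

module Submission where

-- The only term of F_{N,J} that can produce x^e is the weakly increasing index sequence
-- with multiplicities e, so the coefficient of x^e in F_{N,J} is 1 if Σ e = N and J avoids
-- the set E(e) of positions where that sequence repeats its previous entry, and 0
-- otherwise. By inclusion–exclusion the coefficient of x^e in Q_{N,D}(𝒜) is then
-- Σ_{T ⊆ E(e)} (-1)^|T| |{a | D(a) ⊇ T}|; the terms with T not sparse vanish because D is
-- sparse, and the others are (-1)^|T| b_|T|. Now E(e) is a union of runs of e_i - 1
-- consecutive positions separated by non-members, so T is sparse iff it is sparse on every
-- run, and the sum is an iterated sum over the runs. Permuting e only permutes the runs.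

open import Algebra.Properties.CommutativeSemigroup using (x∙yz≈y∙xz)
import Algebra.Properties.CommutativeMonoid.Sum as CommutativeMonoidSum
open import Data.Bool as Bool using (Bool; true; false; _∧_; not; if_then_else_; T; f≤t; b≤b)
open import Data.Bool.Properties using (T-≡; ∧-assoc; ∧-identityʳ; ∧-zeroʳ; ∧-conicalˡ; ∧-conicalʳ)
open import Data.Fin as Fin using (Fin; toℕ; fromℕ<)
open import Data.Fin.Properties using (toℕ-fromℕ<)
open import Data.Fin.Permutation using (Permutation′; _⟨$⟩ʳ_)
open import Data.Fin.Subset using (Subset; _⊆_; ∣_∣)
open import Data.Fin.Subset.Properties using (_⊆?_)
open import Data.Integer as ℤ using (ℤ; 0ℤ; 1ℤ; _-_)
import Data.Integer.Properties as ℤP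
open import Data.Integer.Tactic.RingSolver using (solve-∀)
open import Data.List
  using (List; []; _∷_; _++_; replicate; length; map; concatMap; filter; upTo; tabulate; allFin; foldr)
open import Data.List.Properties using (≡-dec; length-++; length-replicate; filter-none)
open import Data.List.Membership.Propositional using (_∈_)
open import Data.List.Membership.Propositional.Properties using (∈-upTo⁺; ∈-allFin)
open import Data.List.Relation.Binary.Permutation.Propositional as ↭ using (_↭_)
import Data.List.Relation.Binary.Permutation.Propositional.Properties as ↭ₚ
open import Data.List.Relation.Binary.Pointwise using (Pointwise; []; _∷_)
open import Data.List.Relation.Binary.Pointwise.Properties using (Pointwise-length)
open import Data.List.Relation.Unary.All as All using (All; []; _∷_)
import Data.List.Relation.Unary.All.Properties as All
open import Data.List.Relation.Unary.AllPairs using (_∷_)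
open import Data.List.Relation.Unary.Any using (here; there)
open import Data.List.Relation.Unary.Linked as Linked using (Linked; []; [-]; _∷_)
open import Data.List.Relation.Unary.Linked.Properties using (Linked⇒All)
open import Data.List.Relation.Unary.Unique.Propositional using (Unique)
open import Data.List.Relation.Unary.Unique.Propositional.Properties using (upTo⁺)
open import Data.Nat as ℕ using (ℕ; zero; suc; pred; _+_; _<_; _≤_; _<ᵇ_; _≤ᵇ_; _≡ᵇ_; s≤s)
import Data.Nat.Properties as ℕP
open import Data.Nat.ListAction using (sum)
open import Data.Nat.ListAction.Properties using (sum-↭)
open import Data.Product using (_×_; _,_)
open import Data.Vec using ([]; _∷_; toList; here; there)
import Data.Vec.Functional as Vecᶠ
open import Data.Vec.Properties using (length-toList)
open import Function using (_∘_; id)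
open import Function.Bundles using (Equivalence)
open import Relation.Binary.Definitions using (DecidableEquality; tri<; tri≈; tri>)
open import Relation.Binary.PropositionalEquality
  using (_≡_; _≢_; refl; cong; cong₂; sym; trans; subst; subst₂; module ≡-Reasoning)
open import Relation.Nullary using (¬_; does; yes; no; contradiction)
open import Relation.Nullary.Decidable using (T?; dec-true; dec-false)
open import Relation.Unary using (Decidable)

open import Defs

count : {A : Set} → (A → Bool) → List A → ℕ
count p [] = 0
count p (x ∷ xs) = (if p x then 1 else 0) + count p xs

length-filter≡count : {A : Set} {P : A → Set} (P? : Decidable P) (xs : List A) →
  length (filter P? xs) ≡ count (does ∘ P?) xs
length-filter≡count P? [] = refl
length-filter≡count P? (x ∷ xs) with does (P? x)
... | true = cong suc (length-filter≡count P? xs)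
... | false = length-filter≡count P? xs

count-congᴬ : {A : Set} {p q : A → Bool} {xs : List A} →
  All (λ x → p x ≡ q x) xs → count p xs ≡ count q xs
count-congᴬ [] = refl
count-congᴬ {p = p} {xs = x ∷ _} (px≡qx ∷ eqs) rewrite px≡qx =
  cong (λ n → _ + n) (count-congᴬ eqs)

count-none : {A : Set} {p : A → Bool} {xs : List A} → All (λ x → p x ≡ false) xs → count p xs ≡ 0
count-none [] = refl
count-none (px≡false ∷ none) rewrite px≡false = count-none none

count-++ : {A : Set} (p : A → Bool) (xs ys : List A) → count p (xs ++ ys) ≡ count p xs + count p ys
count-++ p [] ys = refl
count-++ p (x ∷ xs) ys =
  trans (cong (λ n → _ + n) (count-++ p xs ys)) (sym (ℕP.+-assoc (if p x then 1 else 0) _ _))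

count-map : {A B : Set} (p : B → Bool) (f : A → B) (xs : List A) →
  count p (map f xs) ≡ count (p ∘ f) xs
count-map p f [] = refl
count-map p f (x ∷ xs) = cong (λ n → _ + n) (count-map p f xs)

module _ {A : Set} (_≟_ : DecidableEquality A) where

  count-≡-unique : {t : A} {xs : List A} → Unique xs → t ∈ xs →
    count (λ x → does (x ≟ t)) xs ≡ 1
  count-≡-unique {t} (t∉xs ∷ _) (here refl) rewrite dec-true (t ≟ t) refl =
    cong suc (count-none (All.map (λ t≢x → dec-false (_ ≟ t) (t≢x ∘ sym)) t∉xs))
  count-≡-unique {t} {x ∷ _} (x∉xs ∷ unique) (there t∈xs)
    rewrite dec-false (x ≟ t) (λ { refl → All.lookup x∉xs t∈xs refl }) =
    count-≡-unique unique t∈xs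

count-upTo : ∀ {y m} → y < m → count (λ x → does (x ℕP.≟ y)) (upTo m) ≡ 1
count-upTo {m = m} y<m = count-≡-unique ℕP._≟_ (upTo⁺ m) (∈-upTo⁺ y<m)

count-∧ʳ : {A : Set} (p : A → Bool) (c : Bool) (xs : List A) →
  count (λ x → p x ∧ c) xs ≡ (if c then count p xs else 0)
count-∧ʳ p true xs = count-congᴬ (All.universal (λ x → ∧-identityʳ (p x)) xs)
count-∧ʳ p false xs = count-none (All.universal (λ x → ∧-zeroʳ (p x)) xs)

_≟ᴸ_ : DecidableEquality (List ℕ)
_≟ᴸ_ = ≡-dec ℕP._≟_

prependAll : ℕ → List (List ℕ) → List (List ℕ)
prependAll m = concatMap (λ s → map (_∷ s) (upTo m))

count-prependAll-[] : ∀ m ss → count (λ s → does (s ≟ᴸ [])) (prependAll m ss) ≡ 0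
count-prependAll-[] m [] = refl
count-prependAll-[] m (s ∷ ss) = begin
  count _ (map (_∷ s) (upTo m) ++ prependAll m ss)  ≡⟨ count-++ _ (map (_∷ s) (upTo m)) _ ⟩
  count _ (map (_∷ s) (upTo m)) + count _ (prependAll m ss)
    ≡⟨ cong₂ _+_ (trans (count-map _ _ (upTo m)) (count-none (All.universal (λ _ → refl) (upTo m))))
                 (count-prependAll-[] m ss) ⟩
  0 ∎
  where open ≡-Reasoning

count-prependAll-∷ : ∀ {m y} t ss → y < m →
  count (λ s → does (s ≟ᴸ (y ∷ t))) (prependAll m ss) ≡ count (λ s → does (s ≟ᴸ t)) ss
count-prependAll-∷ t [] y<m = refl
count-prependAll-∷ {m} {y} t (s ∷ ss) y<m = begin
  count _ (map (_∷ s) (upTo m) ++ prependAll m ss)  ≡⟨ count-++ _ (map (_∷ s) (upTo m)) _ ⟩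
  count _ (map (_∷ s) (upTo m)) + count _ (prependAll m ss)
    ≡⟨ cong₂ _+_ (trans (count-map _ _ (upTo m))
                        (count-∧ʳ (λ x → does (x ℕP.≟ y)) (does (s ≟ᴸ t)) (upTo m)))
                 (count-prependAll-∷ t ss y<m) ⟩
  (if does (s ≟ᴸ t) then count _ (upTo m) else 0) + count _ ss
    ≡⟨ cong (λ n → (if does (s ≟ᴸ t) then n else 0) + count _ ss) (count-upTo y<m) ⟩
  count (λ s → does (s ≟ᴸ t)) (s ∷ ss) ∎
  where open ≡-Reasoning

count-allSeqs : ∀ {m t} N → All (_< m) t →
  count (λ s → does (s ≟ᴸ t)) (allSeqs m N) ≡ (if length t ≡ᵇ N then 1 else 0)
count-allSeqs {t = []} zero _ = refl
count-allSeqs {t = _ ∷ _} zero _ = refl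
count-allSeqs {m} {[]} (suc N) _ = count-prependAll-[] m (allSeqs m N)
count-allSeqs {m} {y ∷ t} (suc N) (y<m ∷ t<m) =
  trans (count-prependAll-∷ t (allSeqs m N) y<m) (count-allSeqs N t<m)

Sorted : List ℕ → Set
Sorted = Linked _≤_

-- occ compares with _≡ᵇ_, which is what does (m ℕP.≟ n) computes to.
occ-here : ∀ x s → occ x (x ∷ s) ≡ suc (occ x s)
occ-here x s rewrite dec-true (x ℕP.≟ x) refl = refl

occ-∷-cancel : ∀ v x s s' → occ v (x ∷ s) ≡ occ v (x ∷ s') → occ v s ≡ occ v s'
occ-∷-cancel v x s s' eq with v ≡ᵇ x
... | true = ℕP.suc-injective eq
... | false = eq

occ-absent : ∀ {v s} → All (v ≢_) s → occ v s ≡ 0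
occ-absent [] = refl
occ-absent {v} {x ∷ _} (v≢x ∷ absent) rewrite dec-false (v ℕP.≟ x) v≢x = occ-absent absent

occ-below : ∀ {x y s} → x < y → All (y ≤_) s → occ x s ≡ 0
occ-below x<y = occ-absent ∘ All.map (λ y≤z → ℕP.<⇒≢ (ℕP.<-≤-trans x<y y≤z))

occ-replicate-≡ : ∀ c k r → occ k (replicate c k ++ r) ≡ c + occ k r
occ-replicate-≡ zero k r = refl
occ-replicate-≡ (suc c) k r = trans (occ-here k (replicate c k ++ r)) (cong suc (occ-replicate-≡ c k r))

occ-replicate-≢ : ∀ {v k} c r → v ≢ k → occ v (replicate c k ++ r) ≡ occ v r
occ-replicate-≢ zero r v≢k = refl
occ-replicate-≢ {v} {k} (suc c) r v≢k rewrite dec-false (v ℕP.≟ k) v≢k = occ-replicate-≢ c r v≢k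

sorted-lowerBound : ∀ {x s} → Sorted (x ∷ s) → All (x ≤_) (x ∷ s)
sorted-lowerBound = Linked⇒All ℕP.≤-trans ℕP.≤-refl

occ-belowHead : ∀ {x y s} → x < y → Sorted (y ∷ s) → occ x (y ∷ s) ≡ 0
occ-belowHead x<y sorted = occ-below x<y (sorted-lowerBound sorted)

sorted-unique : ∀ {s s'} → Sorted s → Sorted s' → (∀ v → occ v s ≡ occ v s') → s ≡ s'
sorted-unique {[]} {[]} _ _ _ = refl
sorted-unique {[]} {y ∷ s'} _ _ eq = contradiction (trans (eq y) (occ-here y s')) ℕP.0≢1+n
sorted-unique {x ∷ s} {[]} _ _ eq = contradiction (trans (sym (eq x)) (occ-here x s)) ℕP.0≢1+n
sorted-unique {x ∷ s} {y ∷ s'} sx sy eq with ℕP.<-cmp x y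
... | tri< x<y _ _ =
  contradiction (trans (sym (occ-here x s)) (trans (eq x) (occ-belowHead x<y sy))) ℕP.1+n≢0
... | tri> _ _ y<x =
  contradiction (trans (sym (occ-here y s')) (trans (sym (eq y)) (occ-belowHead y<x sx))) ℕP.1+n≢0
... | tri≈ _ refl _ =
  cong (x ∷_) (sorted-unique (Linked.tail sx) (Linked.tail sy) (λ v → occ-∷-cancel v x s s' (eq v)))

sortedSeq : ℕ → List ℕ → List ℕ
sortedSeq k [] = []
sortedSeq k (c ∷ cs) = replicate c k ++ sortedSeq (suc k) cs

sortedSeq-sorted′ : ∀ {j k} cs → j ≤ k → Sorted (j ∷ sortedSeq k cs)
sortedSeq-sorted′ [] _ = [-]
sortedSeq-sorted′ (zero ∷ cs) j≤k = sortedSeq-sorted′ cs (ℕP.m≤n⇒m≤1+n j≤k)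
sortedSeq-sorted′ (suc c ∷ cs) j≤k = j≤k ∷ sortedSeq-sorted′ (c ∷ cs) ℕP.≤-refl

sortedSeq-sorted : ∀ k cs → Sorted (sortedSeq k cs)
sortedSeq-sorted k cs = Linked.tail (sortedSeq-sorted′ {k} cs ℕP.≤-refl)

sortedSeq-lowerBound : ∀ k cs → All (k ≤_) (sortedSeq k cs)
sortedSeq-lowerBound k cs = All.tail (sorted-lowerBound (sortedSeq-sorted′ {k} cs ℕP.≤-refl))

sortedSeq-upperBound : ∀ k {m} (e : Fin m → ℕ) → All (_< k + m) (sortedSeq k (tabulate e))
sortedSeq-upperBound k {zero} e = []
sortedSeq-upperBound k {suc m} e =
  All.++⁺ (All.replicate⁺ (e Fin.zero) (ℕP.m<m+n k ℕ.z<s))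
          (subst (λ n → All (_< n) (sortedSeq (suc k) (tabulate (e ∘ Fin.suc))))
                 (sym (ℕP.+-suc k m)) (sortedSeq-upperBound (suc k) (e ∘ Fin.suc)))

length-sortedSeq : ∀ k cs → length (sortedSeq k cs) ≡ sum cs
length-sortedSeq k [] = refl
length-sortedSeq k (c ∷ cs) =
  trans (length-++ (replicate c k)) (cong₂ _+_ (length-replicate c) (length-sortedSeq (suc k) cs))

occ-sortedSeq : ∀ k {m} (e : Fin m → ℕ) i → occ (k + toℕ i) (sortedSeq k (tabulate e)) ≡ e i
occ-sortedSeq k e Fin.zero rewrite ℕP.+-identityʳ k = begin
  occ k (replicate (e Fin.zero) k ++ rest)  ≡⟨ occ-replicate-≡ (e Fin.zero) k rest ⟩
  e Fin.zero + occ k rest                   ≡⟨ cong (e Fin.zero +_) (occ-below (ℕP.n<1+n k) rest≥1+k) ⟩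
  e Fin.zero + 0                            ≡⟨ ℕP.+-identityʳ _ ⟩
  e Fin.zero                                ∎
  where
  open ≡-Reasoning
  rest = sortedSeq (suc k) (tabulate (e ∘ Fin.suc))
  rest≥1+k = sortedSeq-lowerBound (suc k) (tabulate (e ∘ Fin.suc))
occ-sortedSeq k e (Fin.suc i) = begin
  occ (k + suc (toℕ i)) (replicate (e Fin.zero) k ++ rest)
    ≡⟨ occ-replicate-≢ (e Fin.zero) rest (ℕP.m+1+n≢m k) ⟩
  occ (k + suc (toℕ i)) rest
    ≡⟨ cong (λ v → occ v rest) (ℕP.+-suc k (toℕ i)) ⟩
  occ (suc k + toℕ i) rest
    ≡⟨ occ-sortedSeq (suc k) (e ∘ Fin.suc) i ⟩
  e (Fin.suc i) ∎
  where
  open ≡-Reasoning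
  rest = sortedSeq (suc k) (tabulate (e ∘ Fin.suc))

monomialSeq : ∀ {m} → (Fin m → ℕ) → List ℕ
monomialSeq e = sortedSeq 0 (tabulate e)

≡ᵇ≡true⇒≡ : ∀ {m n} → (m ≡ᵇ n) ≡ true → m ≡ n
≡ᵇ≡true⇒≡ {m} {n} eq = ℕP.≡ᵇ⇒≡ m n (subst T (sym eq) _)

allᵇ-sound : {A : Set} (p : A → Bool) (xs : List A) →
  allᵇ p xs ≡ true → All (λ x → p x ≡ true) xs
allᵇ-sound p [] _ = []
allᵇ-sound p (x ∷ xs) eq = ∧-conicalˡ _ _ eq ∷ allᵇ-sound p xs (∧-conicalʳ _ _ eq)

allᵇ-complete : {A : Set} (p : A → Bool) (xs : List A) →
  All (λ x → p x ≡ true) xs → allᵇ p xs ≡ true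
allᵇ-complete p [] [] = refl
allᵇ-complete p (x ∷ xs) (px ∷ pxs) rewrite px = allᵇ-complete p xs pxs

monoIs-sound : ∀ {m} (e : Fin m → ℕ) s → monoIs m e s ≡ true → ∀ v → occ (toℕ v) s ≡ e v
monoIs-sound {m} e s eq v = ≡ᵇ≡true⇒≡ (All.lookup (allᵇ-sound _ (allFin m) eq) (∈-allFin v))

monoIs-monomialSeq : ∀ {m} (e : Fin m → ℕ) → monoIs m e (monomialSeq e) ≡ true
monoIs-monomialSeq {m} e =
  allᵇ-complete _ (allFin m)
    (All.universal (λ v → dec-true (_ ℕP.≟ e v) (occ-sortedSeq 0 e v)) (allFin m))

occ-outOfRange : ∀ {m v s} → All (_< m) s → ¬ v < m → occ v s ≡ 0
occ-outOfRange s<m v≮m = occ-absent (All.map (λ { x<m refl → v≮m x<m }) s<m)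

monomial-unique : ∀ {m} (e : Fin m → ℕ) {s} → Sorted s → All (_< m) s → monoIs m e s ≡ true →
  s ≡ monomialSeq e
monomial-unique {m} e {s} sorted s<m mono = sorted-unique sorted (sortedSeq-sorted 0 (tabulate e)) same-occ
  where
  same-occ : ∀ v → occ v s ≡ occ v (monomialSeq e)
  same-occ v with v ℕP.<? m
  ... | yes v<m = begin
    occ v s                     ≡⟨ cong (λ u → occ u s) (sym (toℕ-fromℕ< v<m)) ⟩
    occ (toℕ i) s               ≡⟨ monoIs-sound e s mono i ⟩
    e i                         ≡⟨ sym (occ-sortedSeq 0 e i) ⟩
    occ (toℕ i) (monomialSeq e) ≡⟨ cong (λ u → occ u (monomialSeq e)) (toℕ-fromℕ< v<m) ⟩
    occ v (monomialSeq e)       ∎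
    where open ≡-Reasoning
          i = fromℕ< v<m
  ... | no v≮m = trans (occ-outOfRange s<m v≮m) (sym (occ-outOfRange (sortedSeq-upperBound 0 e) v≮m))

if<ᵇ≤ᵇ⇒≤ : ∀ b {x y} → (if b then x <ᵇ y else x ≤ᵇ y) ≡ true → x ≤ y
if<ᵇ≤ᵇ⇒≤ true {x} {y} eq = ℕP.<⇒≤ (ℕP.<ᵇ⇒< x y (subst T (sym eq) _))
if<ᵇ≤ᵇ⇒≤ false {x} {y} eq = ℕP.≤ᵇ⇒≤ x y (subst T (sym eq) _)

admissible⇒sorted : ∀ bl s → pred (length s) ≤ length bl → admissible bl s ≡ true → Sorted s
admissible⇒sorted bl [] _ _ = []
admissible⇒sorted bl (x ∷ []) _ _ = [-]
admissible⇒sorted (b ∷ bl) (x ∷ y ∷ s) (s≤s len) eq =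
  if<ᵇ≤ᵇ⇒≤ b (∧-conicalˡ _ _ eq) ∷ admissible⇒sorted bl (y ∷ s) len (∧-conicalʳ _ _ eq)

admissible∧monoIs : ∀ {m} bl (e : Fin m → ℕ) s → pred (length s) ≤ length bl → All (_< m) s →
  (admissible bl s ∧ monoIs m e s) ≡ (does (s ≟ᴸ monomialSeq e) ∧ admissible bl (monomialSeq e))
admissible∧monoIs bl e s len s<m with s ≟ᴸ monomialSeq e
... | yes refl = trans (cong (admissible bl s ∧_) (monoIs-monomialSeq e)) (∧-identityʳ _)
... | no s≢t with admissible bl s in adm | monoIs _ e s in mono
...   | false | _ = refl
...   | true | false = refl
...   | true | true = contradiction (monomial-unique e (admissible⇒sorted bl s len adm) s<m mono) s≢t

allSeqs-members : ∀ m N → All (λ s → length s ≡ N × All (_< m) s) (allSeqs m N)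
allSeqs-members m zero = (refl , []) ∷ []
allSeqs-members m (suc N) =
  All.concat⁺ (All.map⁺ (All.map prepend-members (allSeqs-members m N)))
  where
  prepend-members : ∀ {s} → length s ≡ N × All (_< m) s →
    All (λ s′ → length s′ ≡ suc N × All (_< m) s′) (map (_∷ s) (upTo m))
  prepend-members (len , s<m) = All.map⁺ (All.applyUpTo⁺₁ _ m (λ i<m → cong suc len , i<m ∷ s<m))

coeffF-monomialSeq : ∀ N (J : Subset (pred N)) {m} (e : Fin m → ℕ) →
  coeffF N J m e ≡
    (if admissible (toList J) (monomialSeq e) then (if sum (tabulate e) ≡ᵇ N then 1 else 0) else 0)
coeffF-monomialSeq N J {m} e = begin
  coeffF N J m e
    ≡⟨ length-filter≡count (T? ∘ (λ s → admissible bl s ∧ monoIs m e s)) (allSeqs m N) ⟩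
  count (λ s → admissible bl s ∧ monoIs m e s) (allSeqs m N)
    ≡⟨ count-congᴬ (All.map (λ {s} (len , s<m) → admissible∧monoIs bl e s (bound s len) s<m)
                            (allSeqs-members m N)) ⟩
  count (λ s → does (s ≟ᴸ t) ∧ admissible bl t) (allSeqs m N)
    ≡⟨ count-∧ʳ _ (admissible bl t) (allSeqs m N) ⟩
  (if admissible bl t then count (λ s → does (s ≟ᴸ t)) (allSeqs m N) else 0)
    ≡⟨ cong (λ n → if admissible bl t then n else 0) (count-allSeqs N (sortedSeq-upperBound 0 e)) ⟩
  (if admissible bl t then (if length t ≡ᵇ N then 1 else 0) else 0)
    ≡⟨ cong (λ n → if admissible bl t then (if n ≡ᵇ N then 1 else 0) else 0)
            (length-sortedSeq 0 (tabulate e)) ⟩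
  (if admissible bl t then (if sum (tabulate e) ≡ᵇ N then 1 else 0) else 0) ∎
  where
  open ≡-Reasoning
  bl = toList J
  t = monomialSeq e
  bound : ∀ s → length s ≡ N → pred (length s) ≤ length bl
  bound s len = ℕP.≤-reflexive (trans (cong pred len) (sym (length-toList J)))

-- ieSum E f = Σ_{T ⊆ E} (-1)^|T| f T, subsets of positions being indicator lists.
ieSum : List Bool → (List Bool → ℤ) → ℤ
ieSum [] f = f []
ieSum (false ∷ E) f = ieSum E (f ∘ (false ∷_))
ieSum (true ∷ E) f = ieSum E (f ∘ (false ∷_)) - ieSum E (f ∘ (true ∷_))

_⊑_ : List Bool → List Bool → Set
_⊑_ = Pointwise Bool._≤_

ieSum-congᴾ : ∀ E {f g} → (∀ T → T ⊑ E → f T ≡ g T) → ieSum E f ≡ ieSum E g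
ieSum-congᴾ [] f≡g = f≡g [] []
ieSum-congᴾ (false ∷ E) f≡g = ieSum-congᴾ E (λ T T⊑E → f≡g _ (b≤b ∷ T⊑E))
ieSum-congᴾ (true ∷ E) f≡g =
  cong₂ _-_ (ieSum-congᴾ E (λ T T⊑E → f≡g _ (f≤t ∷ T⊑E))) (ieSum-congᴾ E (λ T T⊑E → f≡g _ (b≤b ∷ T⊑E)))

ieSum-cong : ∀ E {f g} → (∀ T → f T ≡ g T) → ieSum E f ≡ ieSum E g
ieSum-cong E f≡g = ieSum-congᴾ E (λ T _ → f≡g T)

ieSum-zero : ∀ E → ieSum E (λ _ → 0ℤ) ≡ 0ℤ
ieSum-zero [] = refl
ieSum-zero (false ∷ E) = ieSum-zero E
ieSum-zero (true ∷ E) rewrite ieSum-zero E = refl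

ieSum-+ : ∀ E f g → ieSum E f ℤ.+ ieSum E g ≡ ieSum E (λ T → f T ℤ.+ g T)
ieSum-+ [] f g = refl
ieSum-+ (false ∷ E) f g = ieSum-+ E _ _
ieSum-+ (true ∷ E) f g =
  trans (interchange (ieSum E _) (ieSum E _) (ieSum E _) (ieSum E _))
        (cong₂ _-_ (ieSum-+ E _ _) (ieSum-+ E _ _))
  where
  interchange : ∀ (a b c d : ℤ) → (a - b) ℤ.+ (c - d) ≡ (a ℤ.+ c) - (b ℤ.+ d)
  interchange = solve-∀

ieSum-- : ∀ E f g → ieSum E f - ieSum E g ≡ ieSum E (λ T → f T - g T)
ieSum-- [] f g = refl
ieSum-- (false ∷ E) f g = ieSum-- E _ _
ieSum-- (true ∷ E) f g =
  trans (interchange (ieSum E _) (ieSum E _) (ieSum E _) (ieSum E _))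
        (cong₂ _-_ (ieSum-- E _ _) (ieSum-- E _ _))
  where
  interchange : ∀ (a b c d : ℤ) → (a - b) - (c - d) ≡ (a - c) - (b - d)
  interchange = solve-∀

ieSum-comm : ∀ E E' (f : List Bool → List Bool → ℤ) →
  ieSum E (λ T → ieSum E' (f T)) ≡ ieSum E' (λ T' → ieSum E (λ T → f T T'))
ieSum-comm [] E' f = refl
ieSum-comm (false ∷ E) E' f = ieSum-comm E E' _
ieSum-comm (true ∷ E) E' f = trans (cong₂ _-_ (ieSum-comm E E' _) (ieSum-comm E E' _)) (ieSum-- E' _ _)

ieSum-++ : ∀ E E' f → ieSum (E ++ E') f ≡ ieSum E (λ T → ieSum E' (λ T' → f (T ++ T')))
ieSum-++ [] E' f = refl
ieSum-++ (false ∷ E) E' f = ieSum-++ E E' _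
ieSum-++ (true ∷ E) E' f = cong₂ _-_ (ieSum-++ E E' _) (ieSum-++ E E' _)

when : Bool → ℤ → ℤ
when c z = if c then z else 0ℤ

when-comm : ∀ c c' z → when c (when c' z) ≡ when c' (when c z)
when-comm true c' z = refl
when-comm false true z = refl
when-comm false false z = refl

ieSum-when : ∀ E c f → when c (ieSum E f) ≡ ieSum E (when c ∘ f)
ieSum-when E true f = refl
ieSum-when E false f = sym (ieSum-zero E)

⟦_⟧ : Bool → ℤ
⟦ b ⟧ = if b then 1ℤ else 0ℤ

-- Both predicates read a missing entry of the shorter list as false.
disjointᵇ : List Bool → List Bool → Bool
disjointᵇ (x ∷ d) (y ∷ E) = not (x ∧ y) ∧ disjointᵇ d E
disjointᵇ _ _ = true

_⊆ᵇ_ : List Bool → List Bool → Bool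
[] ⊆ᵇ d = true
(false ∷ T) ⊆ᵇ [] = T ⊆ᵇ []
(true ∷ T) ⊆ᵇ [] = false
(false ∷ T) ⊆ᵇ (x ∷ d) = T ⊆ᵇ d
(true ∷ T) ⊆ᵇ (x ∷ d) = x ∧ (T ⊆ᵇ d)

minus-ieSum-zero : ∀ E x → x ≡ x - ieSum E (λ _ → 0ℤ)
minus-ieSum-zero E x rewrite ieSum-zero E = sym (ℤP.+-identityʳ x)

inclusion-exclusion : ∀ E d → ⟦ disjointᵇ d E ⟧ ≡ ieSum E (λ T → ⟦ T ⊆ᵇ d ⟧)
inclusion-exclusion [] [] = refl
inclusion-exclusion [] (x ∷ d) = refl
inclusion-exclusion (false ∷ E) [] = inclusion-exclusion E []
inclusion-exclusion (false ∷ E) (true ∷ d) = inclusion-exclusion E d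
inclusion-exclusion (false ∷ E) (false ∷ d) = inclusion-exclusion E d
inclusion-exclusion (true ∷ E) [] = trans (inclusion-exclusion E []) (minus-ieSum-zero E _)
inclusion-exclusion (true ∷ E) (true ∷ d) = sym (ℤP.+-inverseʳ (ieSum E (λ T → ⟦ T ⊆ᵇ d ⟧)))
inclusion-exclusion (true ∷ E) (false ∷ d) = trans (inclusion-exclusion E d) (minus-ieSum-zero E _)

block : ℕ → List Bool
block zero = []
block (suc c) = false ∷ replicate c true

-- Position p of repeats cs is true iff entry p of sortedSeq k cs equals entry p - 1.
repeats : List ℕ → List Bool
repeats [] = []
repeats (c ∷ cs) = block c ++ repeats cs

length-repeats : ∀ cs → length (repeats cs) ≡ sum cs
length-repeats [] = refl
length-repeats (zero ∷ cs) = length-repeats cs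
length-repeats (suc c ∷ cs) =
  cong suc (trans (length-++ (replicate c true)) (cong₂ _+_ (length-replicate c) (length-repeats cs)))

<ᵇ-irrefl : ∀ k → (k <ᵇ k) ≡ false
<ᵇ-irrefl zero = refl
<ᵇ-irrefl (suc k) = <ᵇ-irrefl k

<⇒<ᵇ≡true : ∀ {x y} → x < y → (x <ᵇ y) ≡ true
<⇒<ᵇ≡true {x} {y} x<y = Equivalence.to T-≡ (ℕP.<⇒<ᵇ x<y)

≤⇒≤ᵇ≡true : ∀ {x y} → x ≤ y → (x ≤ᵇ y) ≡ true
≤⇒≤ᵇ≡true x≤y = Equivalence.to T-≡ (ℕP.≤⇒≤ᵇ x≤y)

admissible-after : ∀ bl {x k} cs → x < k → admissible bl (x ∷ sortedSeq k cs) ≡ disjointᵇ bl (repeats cs)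
admissible-within : ∀ bl {k} c cs →
  admissible bl (k ∷ replicate c k ++ sortedSeq (suc k) cs) ≡ disjointᵇ bl (replicate c true ++ repeats cs)

admissible-after [] [] _ = refl
admissible-after (_ ∷ _) [] _ = refl
admissible-after bl (zero ∷ cs) x<k = admissible-after bl cs (ℕP.m<n⇒m<1+n x<k)
admissible-after [] (suc c ∷ cs) _ = refl
admissible-after (true ∷ bl) (suc c ∷ cs) x<k rewrite <⇒<ᵇ≡true x<k = admissible-within bl c cs
admissible-after (false ∷ bl) (suc c ∷ cs) x<k rewrite ≤⇒≤ᵇ≡true (ℕP.<⇒≤ x<k) = admissible-within bl c cs

admissible-within bl {k} zero cs = admissible-after bl cs (ℕP.n<1+n k)
admissible-within [] (suc c) cs = refl
admissible-within (true ∷ bl) {k} (suc c) cs rewrite <ᵇ-irrefl k = refl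
admissible-within (false ∷ bl) {k} (suc c) cs rewrite ≤⇒≤ᵇ≡true (ℕP.≤-refl {k}) = admissible-within bl c cs

-- The leading false stands for the missing comparison before the first entry.
admissible-sortedSeq : ∀ bl k cs → admissible bl (sortedSeq k cs) ≡ disjointᵇ (false ∷ bl) (repeats cs)
admissible-sortedSeq [] k [] = refl
admissible-sortedSeq (_ ∷ _) k [] = refl
admissible-sortedSeq bl k (zero ∷ cs) = admissible-sortedSeq bl (suc k) cs
admissible-sortedSeq bl k (suc c ∷ cs) = admissible-within bl c cs

coeffF-repeats : ∀ N (J : Subset (pred N)) {m} (e : Fin m → ℕ) →
  ℤ.+ coeffF N J m e ≡ when (sum (tabulate e) ≡ᵇ N) ⟦ disjointᵇ (false ∷ toList J) (repeats (tabulate e)) ⟧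
coeffF-repeats N J e
  rewrite coeffF-monomialSeq N J e | admissible-sortedSeq (toList J) 0 (tabulate e)
  with disjointᵇ (false ∷ toList J) (repeats (tabulate e)) | sum (tabulate e) ≡ᵇ N
... | true | true = refl
... | true | false = refl
... | false | true = refl
... | false | false = refl

sparseᵇ : List Bool → Bool
sparseᵇ (x ∷ y ∷ T) = not (x ∧ y) ∧ sparseᵇ (y ∷ T)
sparseᵇ _ = true

sparseWeight : (ℕ → ℤ) → List Bool → ℤ
sparseWeight w T = when (sparseᵇ T) (w (count id T))

shift : (ℕ → ℤ) → ℕ → ℕ → ℤ
shift w n x = w (n + x)

blockSum : (ℕ → ℤ) → List ℕ → ℤ
blockSum w [] = w 0
blockSum w (c ∷ cs) = ieSum (block c) (λ T → when (sparseᵇ T) (blockSum (shift w (count id T)) cs))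

data FalseHeaded : List Bool → Set where
  [] : FalseHeaded []
  false∷_ : ∀ T → FalseHeaded (false ∷ T)

repeats-falseHeaded : ∀ cs → FalseHeaded (repeats cs)
repeats-falseHeaded [] = []
repeats-falseHeaded (zero ∷ cs) = repeats-falseHeaded cs
repeats-falseHeaded (suc c ∷ cs) = false∷ _

⊑-falseHeaded : ∀ {T E} → T ⊑ E → FalseHeaded E → FalseHeaded T
⊑-falseHeaded [] [] = []
⊑-falseHeaded (b≤b ∷ _) (false∷ _) = false∷ _

sparseᵇ-++ : ∀ R {T} → FalseHeaded T → sparseᵇ (R ++ T) ≡ sparseᵇ R ∧ sparseᵇ T
sparseᵇ-++ [] _ = refl
sparseᵇ-++ (true ∷ []) [] = refl
sparseᵇ-++ (false ∷ []) [] = refl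
sparseᵇ-++ (true ∷ []) (false∷ _) = refl
sparseᵇ-++ (false ∷ []) (false∷ _) = refl
sparseᵇ-++ (x ∷ y ∷ R) T↓ =
  trans (cong (not (x ∧ y) ∧_) (sparseᵇ-++ (y ∷ R) T↓)) (sym (∧-assoc (not (x ∧ y)) _ _))

sparseWeight-++ : ∀ w R {T} → FalseHeaded T →
  sparseWeight w (R ++ T) ≡ when (sparseᵇ R) (sparseWeight (shift w (count id R)) T)
sparseWeight-++ w R {T} T↓ rewrite sparseᵇ-++ R T↓ | count-++ id R T with sparseᵇ R
... | true = refl
... | false = refl

ieSum-repeats : ∀ w cs → ieSum (repeats cs) (sparseWeight w) ≡ blockSum w cs
ieSum-repeats w [] = refl
ieSum-repeats w (c ∷ cs) = begin
  ieSum (block c ++ repeats cs) (sparseWeight w)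
    ≡⟨ ieSum-++ (block c) (repeats cs) (sparseWeight w) ⟩
  ieSum (block c) (λ R → ieSum (repeats cs) (λ T → sparseWeight w (R ++ T)))
    ≡⟨ ieSum-cong (block c) (λ R → ieSum-congᴾ (repeats cs) (λ T T⊑ →
         sparseWeight-++ w R (⊑-falseHeaded T⊑ (repeats-falseHeaded cs)))) ⟩
  ieSum (block c) (λ R → ieSum (repeats cs) (when (sparseᵇ R) ∘ sparseWeight (shift w (count id R))))
    ≡⟨ ieSum-cong (block c) (λ R → sym (ieSum-when (repeats cs) (sparseᵇ R) _)) ⟩
  ieSum (block c) (λ R → when (sparseᵇ R) (ieSum (repeats cs) (sparseWeight (shift w (count id R)))))
    ≡⟨ ieSum-cong (block c) (λ R → cong (when (sparseᵇ R)) (ieSum-repeats _ cs)) ⟩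
  blockSum w (c ∷ cs) ∎
  where open ≡-Reasoning

blockSum-cong : ∀ {w w'} cs → (∀ x → w x ≡ w' x) → blockSum w cs ≡ blockSum w' cs
blockSum-cong [] w≡w' = w≡w' 0
blockSum-cong (c ∷ cs) w≡w' = ieSum-cong (block c) (λ T → cong (when (sparseᵇ T)) (blockSum-cong cs (λ x → w≡w' _)))

blockSum-swap : ∀ w c c' cs → blockSum w (c ∷ c' ∷ cs) ≡ blockSum w (c' ∷ c ∷ cs)
blockSum-swap w c c' cs = begin
  ieSum (block c) (λ T → when (sparseᵇ T) (ieSum (block c') (λ T' → when (sparseᵇ T') (B T T'))))
    ≡⟨ ieSum-cong (block c) (λ T → ieSum-when (block c') (sparseᵇ T) _) ⟩
  ieSum (block c) (λ T → ieSum (block c') (λ T' → when (sparseᵇ T) (when (sparseᵇ T') (B T T'))))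
    ≡⟨ ieSum-comm (block c) (block c') _ ⟩
  ieSum (block c') (λ T' → ieSum (block c) (λ T → when (sparseᵇ T) (when (sparseᵇ T') (B T T'))))
    ≡⟨ ieSum-cong (block c') (λ T' → ieSum-cong (block c) (λ T →
         trans (when-comm (sparseᵇ T) (sparseᵇ T') _)
               (cong (when (sparseᵇ T') ∘ when (sparseᵇ T)) (B-comm T T')))) ⟩
  ieSum (block c') (λ T' → ieSum (block c) (λ T → when (sparseᵇ T') (when (sparseᵇ T) (B T' T))))
    ≡⟨ ieSum-cong (block c') (λ T' → sym (ieSum-when (block c) (sparseᵇ T') _)) ⟩
  ieSum (block c') (λ T' → when (sparseᵇ T') (ieSum (block c) (λ T → when (sparseᵇ T) (B T' T)))) ∎
  where
  open ≡-Reasoning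
  B : List Bool → List Bool → ℤ
  B T T' = blockSum (shift (shift w (count id T)) (count id T')) cs
  B-comm : ∀ T T' → B T T' ≡ B T' T
  B-comm T T' = blockSum-cong cs (λ x →
    cong w (x∙yz≈y∙xz ℕP.+-commutativeSemigroup (count id T) (count id T') x))

blockSum-↭ : ∀ w {cs cs'} → cs ↭ cs' → blockSum w cs ≡ blockSum w cs'
blockSum-↭ w ↭.refl = refl
blockSum-↭ w (↭.prep c p) = ieSum-cong (block c) (λ T → cong (when (sparseᵇ T)) (blockSum-↭ _ p))
blockSum-↭ w (↭.swap {xs} c c' p) = trans (blockSum-swap w c c' xs)
  (ieSum-cong (block c') (λ T' → cong (when (sparseᵇ T'))
    (ieSum-cong (block c) (λ T → cong (when (sparseᵇ T)) (blockSum-↭ _ p)))))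
blockSum-↭ w (↭.trans p q) = trans (blockSum-↭ w p) (blockSum-↭ w q)

∑ : {A : Set} → List A → (A → ℤ) → ℤ
∑ xs f = foldr (λ a acc → f a ℤ.+ acc) 0ℤ xs

∑-cong : {A : Set} (xs : List A) {f g : A → ℤ} → (∀ a → f a ≡ g a) → ∑ xs f ≡ ∑ xs g
∑-cong [] f≡g = refl
∑-cong (x ∷ xs) f≡g = cong₂ ℤ._+_ (f≡g x) (∑-cong xs f≡g)

∑-zero : {A : Set} (xs : List A) → ∑ xs (λ _ → 0ℤ) ≡ 0ℤ
∑-zero [] = refl
∑-zero (x ∷ xs) = trans (ℤP.+-identityˡ _) (∑-zero xs)

∑-ieSum : {A : Set} (xs : List A) (E : List Bool) (f : A → List Bool → ℤ) →
  ∑ xs (λ a → ieSum E (f a)) ≡ ieSum E (λ T → ∑ xs (λ a → f a T))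
∑-ieSum [] E f = sym (ieSum-zero E)
∑-ieSum (x ∷ xs) E f = trans (cong (λ z → ieSum E (f x) ℤ.+ z) (∑-ieSum xs E f)) (ieSum-+ E _ _)

∑-indicator : {A : Set} (p : A → Bool) (xs : List A) → ∑ xs (λ a → ⟦ p a ⟧) ≡ ℤ.+ count p xs
∑-indicator p [] = refl
∑-indicator p (x ∷ xs) with p x
... | true = cong (λ z → 1ℤ ℤ.+ z) (∑-indicator p xs)
... | false = trans (ℤP.+-identityˡ _) (∑-indicator p xs)

+-foldr : {A : Set} (f : A → ℕ) (xs : List A) → ℤ.+ foldr (λ a acc → f a + acc) 0 xs ≡ ∑ xs (ℤ.+_ ∘ f)
+-foldr f [] = refl
+-foldr f (x ∷ xs) = cong (λ z → ℤ.+ f x ℤ.+ z) (+-foldr f xs)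

∑-when : {A : Set} (xs : List A) (c : Bool) (f : A → ℤ) → ∑ xs (when c ∘ f) ≡ when c (∑ xs f)
∑-when xs true f = refl
∑-when xs false f = ∑-zero xs

when-congᵀ : ∀ c {x y} → (c ≡ true → x ≡ y) → when c x ≡ when c y
when-congᵀ true x≡y = x≡y refl
when-congᵀ false x≡y = refl

Sparse-tail : ∀ {n x} {J : Subset n} → Sparse (suc (suc n)) (x ∷ J) → Sparse (suc n) J
Sparse-tail sparse i j j≡1+i i∈J j∈J = sparse (Fin.suc i) (Fin.suc j) (cong suc j≡1+i) (there i∈J) (there j∈J)

Sparse-⊆ : ∀ {N} {J J' : Subset (pred N)} → J ⊆ J' → Sparse N J' → Sparse N J
Sparse-⊆ J⊆J' sparse i j j≡1+i i∈J j∈J = sparse i j j≡1+i (J⊆J' i∈J) (J⊆J' j∈J)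

sparseᵇ-tail : ∀ x T → sparseᵇ (x ∷ T) ≡ true → sparseᵇ T ≡ true
sparseᵇ-tail x [] _ = refl
sparseᵇ-tail x (y ∷ T) sp = ∧-conicalʳ _ _ sp

sparseᵇ-sound : ∀ {n} (J : Subset n) → sparseᵇ (toList J) ≡ true → Sparse (suc n) J
sparseᵇ-sound (true ∷ true ∷ J) () Fin.zero (Fin.suc Fin.zero) refl here (there here)
sparseᵇ-sound (true ∷ false ∷ J) _ Fin.zero (Fin.suc Fin.zero) refl here (there ())
sparseᵇ-sound (x ∷ J) sp (Fin.suc i) (Fin.suc j) j≡1+i (there i∈J) (there j∈J) =
  sparseᵇ-sound J (sparseᵇ-tail x (toList J) sp) i j (ℕP.suc-injective j≡1+i) i∈J j∈J

sparseᵇ-complete : ∀ {n} (J : Subset n) → Sparse (suc n) J → sparseᵇ (toList J) ≡ true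
sparseᵇ-complete [] _ = refl
sparseᵇ-complete (x ∷ []) _ = refl
sparseᵇ-complete (true ∷ true ∷ J) sparse =
  contradiction (sparse Fin.zero (Fin.suc Fin.zero) refl here (there here)) λ ()
sparseᵇ-complete (true ∷ false ∷ J) sparse = sparseᵇ-complete (false ∷ J) (Sparse-tail sparse)
sparseᵇ-complete (false ∷ y ∷ J) sparse = sparseᵇ-complete (y ∷ J) (Sparse-tail sparse)

⊆ᵇ-⊆? : ∀ {n} (J J' : Subset n) → (toList J ⊆ᵇ toList J') ≡ does (J ⊆? J')
⊆ᵇ-⊆? [] [] = refl
⊆ᵇ-⊆? (false ∷ J) (_ ∷ J') = ⊆ᵇ-⊆? J J'
⊆ᵇ-⊆? (true ∷ J) (false ∷ J') = refl
⊆ᵇ-⊆? (true ∷ J) (true ∷ J') = ⊆ᵇ-⊆? J J'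

∣∣≡count : ∀ {n} (J : Subset n) → ∣ J ∣ ≡ count id (toList J)
∣∣≡count [] = refl
∣∣≡count (true ∷ J) = cong suc (∣∣≡count J)
∣∣≡count (false ∷ J) = ∣∣≡count J

toSubset : ∀ n → List Bool → Subset n
toSubset zero T = []
toSubset (suc n) [] = false ∷ toSubset n []
toSubset (suc n) (x ∷ T) = x ∷ toSubset n T

toList-toSubset : ∀ n T → length T ≡ n → toList (toSubset n T) ≡ T
toList-toSubset zero [] _ = refl
toList-toSubset (suc n) (x ∷ T) len = cong (x ∷_) (toList-toSubset n T (ℕP.suc-injective len))

sparseᵇ-false∷ : ∀ T → sparseᵇ (false ∷ T) ≡ sparseᵇ T
sparseᵇ-false∷ [] = refl
sparseᵇ-false∷ (x ∷ T) = refl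

module Coefficients (N k : ℕ) (D : Fin k → Subset (pred N)) (D-sparse : ∀ a → Sparse N (D a))
         (b : ℕ → ℕ) (count-b : ∀ J → Sparse N J → countSuper N k D J ≡ b ∣ J ∣) where

  weight : ℕ → ℤ
  weight = ℤ.+_ ∘ b

  countSuper-sparseWeight : ∀ J → ℤ.+ countSuper N k D J ≡ sparseWeight weight (toList J)
  countSuper-sparseWeight J with sparseᵇ (toList J) in sparse
  ... | true = cong ℤ.+_ (trans (count-b J (sparseᵇ-sound J sparse)) (cong b (∣∣≡count J)))
  ... | false = cong (ℤ.+_ ∘ length) (filter-none (λ a → J ⊆? D a) (All.universal notSuper (allFin k)))
    where
    notSuper : ∀ a → ¬ (J ⊆ D a)
    notSuper a J⊆Da =
      contradiction (trans (sym (sparseᵇ-complete J (Sparse-⊆ {N} J⊆Da (D-sparse a)))) sparse) λ ()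

  supersets-sparseWeight : ∀ T → length T ≡ pred N →
    ∑ (allFin k) (λ a → ⟦ T ⊆ᵇ toList (D a) ⟧) ≡ sparseWeight weight T
  supersets-sparseWeight T len =
    subst (λ T → ∑ (allFin k) (λ a → ⟦ T ⊆ᵇ toList (D a) ⟧) ≡ sparseWeight weight T)
          (toList-toSubset (pred N) T len) (begin
      ∑ (allFin k) (λ a → ⟦ toList J ⊆ᵇ toList (D a) ⟧)
        ≡⟨ ∑-cong (allFin k) (λ a → cong ⟦_⟧ (⊆ᵇ-⊆? J (D a))) ⟩
      ∑ (allFin k) (λ a → ⟦ does (J ⊆? D a) ⟧)
        ≡⟨ ∑-indicator (λ a → does (J ⊆? D a)) (allFin k) ⟩
      ℤ.+ count (λ a → does (J ⊆? D a)) (allFin k)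
        ≡⟨ cong ℤ.+_ (sym (length-filter≡count (λ a → J ⊆? D a) (allFin k))) ⟩
      ℤ.+ countSuper N k D J
        ≡⟨ countSuper-sparseWeight J ⟩
      sparseWeight weight (toList J) ∎)
    where
    open ≡-Reasoning
    J = toSubset (pred N) T

  supersets-falseHeaded : ∀ T → length T ≡ N → FalseHeaded T →
    ∑ (allFin k) (λ a → ⟦ T ⊆ᵇ (false ∷ toList (D a)) ⟧) ≡ sparseWeight weight T
  supersets-falseHeaded [] len [] = supersets-sparseWeight [] (cong pred len)
  supersets-falseHeaded (false ∷ T) len (false∷ T) =
    trans (supersets-sparseWeight T (cong pred len))
          (cong (λ c → when c (weight (count id T))) (sym (sparseᵇ-false∷ T)))

  coeffQ-blockSum : ∀ {m} (e : Fin m → ℕ) →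
    ℤ.+ coeffQ N k D m e ≡ when (sum (tabulate e) ≡ᵇ N) (blockSum weight (tabulate e))
  coeffQ-blockSum {m} e = begin
    ℤ.+ coeffQ N k D m e
      ≡⟨ +-foldr (λ a → coeffF N (D a) m e) (allFin k) ⟩
    ∑ (allFin k) (λ a → ℤ.+ coeffF N (D a) m e)
      ≡⟨ ∑-cong (allFin k) (λ a → coeffF-repeats N (D a) e) ⟩
    ∑ (allFin k) (λ a → when c ⟦ disjointᵇ (false ∷ toList (D a)) (repeats es) ⟧)
      ≡⟨ ∑-when (allFin k) c _ ⟩
    when c (∑ (allFin k) (λ a → ⟦ disjointᵇ (false ∷ toList (D a)) (repeats es) ⟧))
      ≡⟨ when-congᵀ c (inclusion-exclusion-blockSum ∘ ≡ᵇ≡true⇒≡) ⟩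
    when c (blockSum weight es) ∎
    where
    open ≡-Reasoning
    es = tabulate e
    c = sum es ≡ᵇ N
    inclusion-exclusion-blockSum : sum es ≡ N →
      ∑ (allFin k) (λ a → ⟦ disjointᵇ (false ∷ toList (D a)) (repeats es) ⟧) ≡ blockSum weight es
    inclusion-exclusion-blockSum sum≡N = begin
      ∑ (allFin k) (λ a → ⟦ disjointᵇ (false ∷ toList (D a)) (repeats es) ⟧)
        ≡⟨ ∑-cong (allFin k) (λ a → inclusion-exclusion (repeats es) _) ⟩
      ∑ (allFin k) (λ a → ieSum (repeats es) (λ T → ⟦ T ⊆ᵇ (false ∷ toList (D a)) ⟧))
        ≡⟨ ∑-ieSum (allFin k) (repeats es) _ ⟩
      ieSum (repeats es) (λ T → ∑ (allFin k) (λ a → ⟦ T ⊆ᵇ (false ∷ toList (D a)) ⟧))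
        ≡⟨ ieSum-congᴾ (repeats es) (λ T T⊑ → supersets-falseHeaded T
             (trans (Pointwise-length T⊑) (trans (length-repeats es) sum≡N))
             (⊑-falseHeaded T⊑ (repeats-falseHeaded es))) ⟩
      ieSum (repeats es) (sparseWeight weight)
        ≡⟨ ieSum-repeats weight es ⟩
      blockSum weight es ∎

-- Sum the singletons [e v] in the commutative monoid of lists under _++_ up to _↭_.
tabulate-↭ : ∀ {m} (e : Fin m → ℕ) (σ : Permutation′ m) → tabulate e ↭ tabulate (λ v → e (σ ⟨$⟩ʳ v))
tabulate-↭ e σ = subst₂ _↭_ (concat-singletons e) (concat-singletons (λ v → e (σ ⟨$⟩ʳ v)))
                        (ListMonoid.sum-permute (λ v → e v ∷ []) σ)
  where
  module ListMonoid = CommutativeMonoidSum (↭ₚ.++-commutativeMonoid {A = ℕ})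
  concat-singletons : ∀ {m} (f : Fin m → ℕ) → Vecᶠ.foldr _++_ [] (λ v → f v ∷ []) ≡ tabulate f
  concat-singletons {zero} f = refl
  concat-singletons {suc m} f = cong (f Fin.zero ∷_) (concat-singletons (f ∘ Fin.suc))

lemma3p5 : (N k : ℕ) (D : Fin k → Subset (pred N)) →
    ((a : Fin k) → Sparse N (D a)) →
    (b : ℕ → ℕ) →
    ((J : Subset (pred N)) → Sparse N J → countSuper N k D J ≡ b ∣ J ∣) →
    IsSymmetric N k D
lemma3p5 N k D D-sparse b count-b m e σ = ℤP.+-injective (begin
  ℤ.+ coeffQ N k D m e
    ≡⟨ coeffQ-blockSum e ⟩
  when (sum es ≡ᵇ N) (blockSum weight es)
    ≡⟨ cong₂ (λ s z → when (s ≡ᵇ N) z) (sum-↭ es↭es′) (blockSum-↭ weight es↭es′) ⟩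
  when (sum es′ ≡ᵇ N) (blockSum weight es′)
    ≡⟨ sym (coeffQ-blockSum (λ v → e (σ ⟨$⟩ʳ v))) ⟩
  ℤ.+ coeffQ N k D m (λ v → e (σ ⟨$⟩ʳ v)) ∎)
  where
  open ≡-Reasoning
  open Coefficients N k D D-sparse b count-b
  es = tabulate e
  es′ = tabulate (λ v → e (σ ⟨$⟩ʳ v))
  es↭es′ = tabulate-↭ e σ
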